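{- Let $\mathsf{K}$ be a class of $\mathcal{L}$-lattices that is closed under taking direct limits and subalgebras and has the superamalgamation property. Then every member of $\mathsf{mK}$ is $\mathsf{K}$-functional.
   Context: $\mathcal{L}$ is a lattice-oriented signature: an algebraic signature (with $\mathcal{L}_n$ its $n$-ary operation symbols) containing distinct binary symbols $\land,\lor$. An $\mathcal{L}$-lattice is an algebra of signature $\mathcal{L}$ whose $\{\land,\lor\}$-reduct is a lattice. An m-lattice is an algebra $\langle L,\land,\lor,\Box,\Diamond\rangle$ with lattice reduct satisfying $\Box x\land x\approx \Box x$, $\Box(x\land y)\approx\Box x\land\Box y$, $\Box\Diamond x\approx\Diamond x$, $\Diamond x\lor x\approx\Diamond x$, $\Diamond(x\lor y)\approx\Diamond x\lor\Diamond y$, $\Diamond\Box x\approx\Box x$; an m-$\mathcal{L}$-lattice is $\langle\mathbf{A},\Box,\Diamond\rangle$ with $\mathbf{A}$ an $\mathcal{L}$-lattice, $\langle A,\land,\lor,\Box,\Diamond\rangle$ an m-lattice, and $\Box(\star(\Box x_1,\dots,\Box x_n))\approx\star(\Box x_1,\dots,\Box x_n)$ for all $\star\in\mathcal{L}_n$. $\mathsf{mK}$ is the class of m-$\mathcal{L}$-lattices whose $\mathcal{L}$-lattice reduct is in $\mathsf{K}$. An $\langle\mathbf{A},W\rangle$-functional m-$\mathcal{L}$-lattice ($\mathbf{A}$ an $\mathcal{L}$-lattice, $W$ a set) is $\langle\mathbf{B},\Box,\Diamond\rangle$ with $\mathbf{B}$ a subalgebra of $\mathbf{A}^W$ (pointwise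 operations) such that for each $f\in B$, $\bigwedge_{v\in W}f(v)$ and $\bigvee_{v\in W}f(v)$ exist in $\mathbf{A}$ and the constant functions $\Box f\colon u\mapsto\bigwedge_vf(v)$, $\Diamond f\colon u\mapsto\bigvee_vf(v)$ lie in $B$. An m-$\mathcal{L}$-lattice is $\mathsf{K}$-functional if it is isomorphic to an $\langle\mathbf{A},W\rangle$-functional m-$\mathcal{L}$-lattice for some $\mathbf{A}\in\mathsf{K}$ and set $W$. A V-formation in $\mathsf{K}$ is $\langle\mathbf{A},\mathbf{B}_1,\mathbf{B}_2,f_1,f_2\rangle$ with $\mathbf{A},\mathbf{B}_1,\mathbf{B}_2\in\mathsf{K}$ and embeddings $f_i\colon\mathbf{A}\to\mathbf{B}_i$. A superamalgam of it in $\mathsf{K}$ is $\langle\mathbf{C},g_1,g_2\rangle$ with $\mathbf{C}\in\mathsf{K}$ and embeddings $g_i\colon\mathbf{B}_i\to\mathbf{C}$ such that $g_1\circ f_1=g_2\circ f_2$ and, for all $b_1\in B_1$, $b_2\in B_2$ and distinct $i,j\in\{1,2\}$, if $g_i(b_i)\le g_j(b_j)$ then there is $a\in A$ with $g_i(b_i)\le g_i(f_i(a))=g_j(f_j(a))\le g_j(b_j)$. $\mathsf{K}$ has the superamalgamation property if every V-formation in $\mathsf{K}$ has a superamalgam in $\mathsf{K}$. -}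

module Defs where

open import Level using (Level; _⊔_; suc)
open import Data.Nat using (ℕ)
open import Data.Fin using (Fin; zero)
open import Data.Product using (Σ; Σ-syntax; ∃; ∃-syntax; _×_; _,_; proj₁)
open import Relation.Binary.Core using (Rel)
open import Relation.Binary.Structures using (IsEquivalence)
open import Relation.Binary.PropositionalEquality using (_≢_)
open import Relation.Unary using (Pred)
open import Algebra.Lattice.Structures using (IsLattice)
open import Data.Vec.Functional using ([]; _∷_)

record Signature : Set₁ where
  field
    Op   : ℕ → Set
    ∧op  : Op 2
    ∨op  : Op 2
    ∧≢∨  : ∧op ≢ ∨op

record Algebra (𝓛 : Signature) (a : Level) : Set (suc a) where
  open Signature 𝓛
  infix 4 _≈_
  field
    Carrier       : Set a
    _≈_           : Rel Carrier a
    isEquivalence : IsEquivalence _≈_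
    ⟦_⟧           : ∀ {n} → Op n → (Fin n → Carrier) → Carrier
    ⟦⟧-cong       : ∀ {n} (o : Op n) {xs ys : Fin n → Carrier} →
                    (∀ i → xs i ≈ ys i) → ⟦ o ⟧ xs ≈ ⟦ o ⟧ ys

  infixr 7 _∧_
  infixr 6 _∨_
  _∧_ : Carrier → Carrier → Carrier
  x ∧ y = ⟦ ∧op ⟧ (x ∷ y ∷ [])
  _∨_ : Carrier → Carrier → Carrier
  x ∨ y = ⟦ ∨op ⟧ (x ∷ y ∷ [])

  infix 4 _≤_
  _≤_ : Rel Carrier a
  x ≤ y = x ∧ y ≈ x

record LLattice (𝓛 : Signature) (a : Level) : Set (suc a) where
  field
    algebra   : Algebra 𝓛 a
  open Algebra algebra public
  field
    isLattice : IsLattice _≈_ _∨_ _∧_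

record MLLattice (𝓛 : Signature) (a : Level) : Set (suc a) where
  open Signature 𝓛
  field
    lattice : LLattice 𝓛 a
  open LLattice lattice public
  field
    □ ◇     : Carrier → Carrier
    □-cong  : ∀ {x y} → x ≈ y → □ x ≈ □ y
    ◇-cong  : ∀ {x y} → x ≈ y → ◇ x ≈ ◇ y
    ax1 : ∀ x → □ x ∧ x ≈ □ x
    ax2 : ∀ x y → □ (x ∧ y) ≈ □ x ∧ □ y
    ax3 : ∀ x → □ (◇ x) ≈ ◇ x
    ax4 : ∀ x → ◇ x ∨ x ≈ ◇ x
    ax5 : ∀ x y → ◇ (x ∨ y) ≈ ◇ x ∨ ◇ y
    ax6 : ∀ x → ◇ (□ x) ≈ □ x
    ax7 : ∀ {n} (o : Op n) (xs : Fin n → Carrier) →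
          □ (⟦ o ⟧ (λ i → □ (xs i))) ≈ ⟦ o ⟧ (λ i → □ (xs i))

Class : Signature → (a k : Level) → Set (suc a ⊔ suc k)
Class 𝓛 a k = LLattice 𝓛 a → Set k

_∈m_ : ∀ {𝓛 a k} → MLLattice 𝓛 a → Class 𝓛 a k → Set k
M ∈m K = K (MLLattice.lattice M)

module _ {𝓛 : Signature} {a : Level} where
  open Signature 𝓛

  record IsHom (A B : LLattice 𝓛 a)
               (h : LLattice.Carrier A → LLattice.Carrier B) : Set a where
    private
      module A = LLattice A
      module B = LLattice B
    field
      cong : ∀ {x y} → x A.≈ y → h x B.≈ h y
      hom  : ∀ {n} (o : Op n) (xs : Fin n → A.Carrier) →
             h (A.⟦ o ⟧ xs) B.≈ B.⟦ o ⟧ (λ i → h (xs i))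

  record Hom (A B : LLattice 𝓛 a) : Set a where
    field
      fun   : LLattice.Carrier A → LLattice.Carrier B
      isHom : IsHom A B fun
    open IsHom isHom public

  record Embedding (A B : LLattice 𝓛 a) : Set a where
    field
      hom       : Hom A B
    open Hom hom public
    field
      injective : ∀ {x y} → LLattice._≈_ B (fun x) (fun y) → LLattice._≈_ A x y

  open Hom using (fun)

  record DirectedSystem : Set (suc a) where
    field
      I        : Set a
      _≼_      : Rel I a
      ≼-refl   : ∀ i → i ≼ i
      ≼-trans  : ∀ {i j k} → i ≼ j → j ≼ k → i ≼ k
      inhabited : I
      directed : ∀ i j → ∃[ k ] (i ≼ k × j ≼ k)
      D        : I → LLattice 𝓛 a
      f        : ∀ {i j} → i ≼ j → Hom (D i) (D j)
      f-id     : ∀ {i} (p : i ≼ i) (x : LLattice.Carrier (D i)) →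
                 LLattice._≈_ (D i) (fun (f p) x) x
      f-comp   : ∀ {i j k} (p : i ≼ j) (q : j ≼ k) (r : i ≼ k)
                 (x : LLattice.Carrier (D i)) →
                 LLattice._≈_ (D k) (fun (f q) (fun (f p) x)) (fun (f r) x)

  record Cocone (S : DirectedSystem) (C : LLattice 𝓛 a) : Set a where
    open DirectedSystem S
    field
      g      : ∀ i → Hom (D i) C
      g-comm : ∀ {i j} (p : i ≼ j) (x : LLattice.Carrier (D i)) →
               LLattice._≈_ C (fun (g j) (fun (f p) x)) (fun (g i) x)

  IsDirectLimit : (S : DirectedSystem) (C : LLattice 𝓛 a) → Cocone S C →
                  Set (suc a)
  IsDirectLimit S C γ =
    (E : LLattice 𝓛 a) (ε : Cocone S E) →
    Σ[ u ∈ Hom C E ]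
      ( (∀ i x → LLattice._≈_ E (fun u (fun (Cocone.g γ i) x))
                                 (fun (Cocone.g ε i) x))
      × (∀ (u' : Hom C E) →
           (∀ i x → LLattice._≈_ E (fun u' (fun (Cocone.g γ i) x))
                                    (fun (Cocone.g ε i) x)) →
           ∀ y → LLattice._≈_ E (fun u' y) (fun u y)))

module _ {𝓛 : Signature} {a k : Level} (K : Class 𝓛 a k) where

  ClosedUnderDirectLimits : Set (suc a ⊔ k)
  ClosedUnderDirectLimits =
    (S : DirectedSystem {𝓛} {a}) → (∀ i → K (DirectedSystem.D S i)) →
    (C : LLattice 𝓛 a) (γ : Cocone S C) → IsDirectLimit S C γ → K C

  -- subalgebras taken up to isomorphism: anything embeddable in a member
  ClosedUnderSubalgebras : Set (suc a ⊔ k)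
  ClosedUnderSubalgebras =
    (A B : LLattice 𝓛 a) → Embedding B A → K A → K B

  record VFormation : Set (suc a ⊔ k) where
    field
      A B₁ B₂ : LLattice 𝓛 a
      A∈K     : K A
      B₁∈K    : K B₁
      B₂∈K    : K B₂
      f₁      : Embedding A B₁
      f₂      : Embedding A B₂

  record Superamalgam (V : VFormation) : Set (suc a ⊔ k) where
    open VFormation V
    open Embedding using (fun)
    field
      C    : LLattice 𝓛 a
      C∈K  : K C
      g₁   : Embedding B₁ C
      g₂   : Embedding B₂ C
    open LLattice C using (_≈_; _≤_)
    field
      comm : ∀ x → fun g₁ (fun f₁ x) ≈ fun g₂ (fun f₂ x)
      super₁₂ : ∀ b₁ b₂ → fun g₁ b₁ ≤ fun g₂ b₂ →
                ∃[ x ] (fun g₁ b₁ ≤ fun g₁ (fun f₁ x)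
                        × fun g₁ (fun f₁ x) ≈ fun g₂ (fun f₂ x)
                        × fun g₂ (fun f₂ x) ≤ fun g₂ b₂)
      super₂₁ : ∀ b₁ b₂ → fun g₂ b₂ ≤ fun g₁ b₁ →
                ∃[ x ] (fun g₂ b₂ ≤ fun g₂ (fun f₂ x)
                        × fun g₂ (fun f₂ x) ≈ fun g₁ (fun f₁ x)
                        × fun g₁ (fun f₁ x) ≤ fun g₁ b₁)

  SuperamalgamationProperty : Set (suc a ⊔ k)
  SuperamalgamationProperty = (V : VFormation) → Superamalgam V

module _ {𝓛 : Signature} {a : Level} (A : LLattice 𝓛 a) (W : Set a) where
  open Signature 𝓛
  open LLattice A

  IsMeet : (W → Carrier) → Carrier → Set a
  IsMeet f m = (∀ v → m ≤ f v) × (∀ z → (∀ v → z ≤ f v) → z ≤ m)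

  IsJoin : (W → Carrier) → Carrier → Set a
  IsJoin f m = (∀ v → f v ≤ m) × (∀ z → (∀ v → f v ≤ z) → m ≤ z)

  record Functional : Set (suc a) where
    field
      B       : Pred (W → Carrier) a
      closed  : ∀ {n} (o : Op n) (fs : Fin n → W → Carrier) →
                (∀ i → B (fs i)) → B (λ v → ⟦ o ⟧ (λ i → fs i v))
      ⋀       : ∀ f → B f → Carrier
      ⋀-meet  : ∀ f (p : B f) → IsMeet f (⋀ f p)
      ⋁       : ∀ f → B f → Carrier
      ⋁-join  : ∀ f (p : B f) → IsJoin f (⋁ f p)
      □-in    : ∀ f (p : B f) → B (λ _ → ⋀ f p)
      ◇-in    : ∀ f (p : B f) → B (λ _ → ⋁ f p)

    Elem : Set a
    Elem = Σ (W → Carrier) B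

    _≐_ : Rel Elem a
    (f , _) ≐ (g , _) = ∀ v → f v ≈ g v

    op : ∀ {n} → Op n → (Fin n → Elem) → Elem
    op o xs = (λ v → ⟦ o ⟧ (λ i → proj₁ (xs i) v)) ,
              closed o (λ i → proj₁ (xs i)) (λ i → Data.Product.proj₂ (xs i))

    □f : Elem → Elem
    □f (f , p) = (λ _ → ⋀ f p) , □-in f p

    ◇f : Elem → Elem
    ◇f (f , p) = (λ _ → ⋁ f p) , ◇-in f p

module _ {𝓛 : Signature} {a : Level} where
  open Signature 𝓛

  record IsoToFunctional (M : MLLattice 𝓛 a) (A : LLattice 𝓛 a) (W : Set a)
                         (F : Functional A W) : Set a where
    open Functional F
    private module M = MLLattice M
    field
      h         : M.Carrier → Elem
      h-cong    : ∀ {x y} → x M.≈ y → h x ≐ h y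
      h-inj     : ∀ {x y} → h x ≐ h y → x M.≈ y
      h-surj    : ∀ (e : Elem) → ∃[ x ] (h x ≐ e)
      h-op      : ∀ {n} (o : Op n) (xs : Fin n → M.Carrier) →
                  h (M.⟦ o ⟧ xs) ≐ op o (λ i → h (xs i))
      h-□       : ∀ x → h (M.□ x) ≐ □f (h x)
      h-◇       : ∀ x → h (M.◇ x) ≐ ◇f (h x)

  KFunctional : ∀ {k} → Class 𝓛 a k → MLLattice 𝓛 a → Set (suc a ⊔ k)
  KFunctional K M =
    Σ[ A ∈ LLattice 𝓛 a ] (K A × Σ[ W ∈ Set a ] Σ[ F ∈ Functional A W ]
       IsoToFunctional M A W F)

{-# OPTIONS --safe #-}
-- The □-fixed elements of M form a subalgebra S, which lies in K.  Starting from A₀ = M,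
-- superamalgamate Aₙ and M over S to obtain Aₙ₊₁; the union A of this chain lies in K, and
-- x ↦ (n ↦ image of x in Aₙ) represents M by functions ℕ → A.  The meet of the values of x is
-- □ x: if z ∈ Aₘ lies below x in Aₘ₊₁, superamalgamation interpolates some s ∈ S with z ≤ s in
-- Aₘ₊₁ and s ≤ x in M, and s ≤ □ x since s is fixed.  Dually, the join is ◇ x.

module Submission where

open import Defs
open import Level using (Level; Lift; lift; lower)
open import Function using (_∘_)
open import Data.Empty using (⊥; ⊥-elim)
open import Data.Nat using (ℕ; zero; suc; _⊔_; _≤′_; ≤′-refl; ≤′-step)
open import Data.Nat.Properties using (≤′-trans; z≤′n; ≤⇒≤′; ≤′⇒≤; m≤m⊔n; m≤n⊔m; ⊔-lub; 1+n≰n)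
open import Data.Fin using (Fin; zero; suc)
open import Data.Product using (Σ; ∃-syntax; _×_; _,_; proj₁; proj₂)
open import Data.Vec.Functional using ([]; _∷_)
open import Relation.Binary.Bundles using (Setoid)
open import Relation.Unary using (Pred)
open import Algebra.Lattice.Bundles using (Lattice)
open import Algebra.Lattice.Structures using (IsLattice)
open import Algebra.Lattice.Morphism.Structures using (IsLatticeMonomorphism)
import Algebra.Lattice.Morphism.LatticeMonomorphism as LatticeMonomorphism
import Algebra.Lattice.Properties.Lattice as LatticeProperties
import Relation.Binary.Lattice as OrderTheoretic
import Relation.Binary.Reasoning.Setoid as ≈-Reasoning
import Algebra.Definitions as AlgebraDefinitions

module LatticeOrder {𝓛 : Signature} {a : Level} (L : LLattice 𝓛 a) where
  open Signature 𝓛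
  open LLattice L

  setoid : Setoid a a
  setoid = record { isEquivalence = isEquivalence }

  open Setoid setoid public using (refl; sym; trans)

  ⟦⟧₂-cong : (o : Op 2) {xs : Fin 2 → Carrier} {x y : Carrier} →
             xs zero ≈ x → xs (suc zero) ≈ y → ⟦ o ⟧ xs ≈ ⟦ o ⟧ (x ∷ y ∷ [])
  ⟦⟧₂-cong o p q = ⟦⟧-cong o λ { zero → p ; (suc zero) → q }

  -- Here x ≤ y is x ∧ y ≈ x, the library's natural order is x ≈ x ∧ y: hence the uses of sym.
  private
    bundle : Lattice a a
    bundle = record { isLattice = isLattice }

    module O = OrderTheoretic.Lattice (LatticeProperties.∨-∧-orderTheoreticLattice bundle)

  ≤-trans : ∀ {x y z} → x ≤ y → y ≤ z → x ≤ z
  ≤-trans p q = sym (O.trans (sym p) (sym q))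

  ≤-antisym : ∀ {x y} → x ≤ y → y ≤ x → x ≈ y
  ≤-antisym p q = O.antisym (sym p) (sym q)

  ≤-resp-≈ : ∀ {x x′ y y′} → x ≈ x′ → y ≈ y′ → x ≤ y → x′ ≤ y′
  ≤-resp-≈ p q r = sym (O.≤-respʳ-≈ q (O.≤-respˡ-≈ p (sym r)))

  x≤y∨x : ∀ x y → x ≤ y ∨ x
  x≤y∨x x y = sym (O.y≤x∨y y x)

  ≤⇒∨≈ : ∀ {x y} → x ≤ y → y ∨ x ≈ y
  ≤⇒∨≈ {x} {y} p = ≤-antisym (sym (O.∨-least O.refl (sym p))) (sym (O.x≤x∨y y x))

module _ {𝓛 : Signature} {a : Level} {A B : LLattice 𝓛 a} where
  open Signature 𝓛
  private
    module A = LLattice A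
    module B = LLattice B
    module B′ = LatticeOrder B

  ∧-homo : (h : Hom A B) → ∀ x y → Hom.fun h (x A.∧ y) B.≈ Hom.fun h x B.∧ Hom.fun h y
  ∧-homo h x y = B′.trans (Hom.hom h ∧op (x ∷ y ∷ [])) (B′.⟦⟧₂-cong ∧op B′.refl B′.refl)

  ≤-homo : (h : Hom A B) → ∀ {x y} → x A.≤ y → Hom.fun h x B.≤ Hom.fun h y
  ≤-homo h {x} {y} p = B′.trans (B′.sym (∧-homo h x y)) (Hom.cong h p)

  toHom : Embedding A B → Hom A B
  toHom h = record { fun = Embedding.fun h ; isHom = Embedding.isHom h }

  ≤-reflect : (h : Embedding A B) → ∀ {x y} →
              Embedding.fun h x B.≤ Embedding.fun h y → x A.≤ y
  ≤-reflect h {x} {y} p = Embedding.injective h (B′.trans (∧-homo (toHom h) x y) p)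

module _ {𝓛 : Signature} {a : Level} where

  idᴱ : (A : LLattice 𝓛 a) → Embedding A A
  idᴱ A = record
    { hom       = record { fun = λ x → x ; isHom = record { cong = λ p → p ; hom = λ _ _ → refl } }
    ; injective = λ p → p }
    where open LatticeOrder A using (refl)

  _∘ᴱ_ : {A B C : LLattice 𝓛 a} → Embedding B C → Embedding A B → Embedding A C
  _∘ᴱ_ {C = C} g f = record
    { hom       = record
      { fun   = λ x → Embedding.fun g (Embedding.fun f x)
      ; isHom = record
        { cong = λ p → Embedding.cong g (Embedding.cong f p)
        ; hom  = λ o xs →
            trans (Embedding.cong g (Hom.hom (toHom f) o xs)) (Hom.hom (toHom g) o _) } }
    ; injective = λ p → Embedding.injective f (Embedding.injective g p) }
    where open LatticeOrder C using (trans)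

module Subalgebra {𝓛 : Signature} {a : Level} (L : LLattice 𝓛 a)
  (P : Pred (LLattice.Carrier L) a)
  (closed : ∀ {n} (o : Signature.Op 𝓛 n) (xs : Fin n → LLattice.Carrier L) →
            (∀ i → P (xs i)) → P (LLattice.⟦ L ⟧ o xs)) where
  open Signature 𝓛
  private
    module L = LLattice L
    module L′ = LatticeOrder L

  algebra : Algebra 𝓛 a
  algebra = record
    { Carrier       = Σ L.Carrier P
    ; _≈_           = λ x y → proj₁ x L.≈ proj₁ y
    ; isEquivalence = record { refl = L′.refl ; sym = L′.sym ; trans = L′.trans }
    ; ⟦_⟧           = λ o xs → L.⟦ o ⟧ (λ i → proj₁ (xs i)) , closed o _ (λ i → proj₂ (xs i))
    ; ⟦⟧-cong       = λ o → L.⟦⟧-cong o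
    }

  private
    module S = Algebra algebra

    proj₁-isMonomorphism : IsLatticeMonomorphism
      (record { _≈_ = S._≈_ ; _∧_ = S._∧_ ; _∨_ = S._∨_ })
      (record { _≈_ = L._≈_ ; _∧_ = L._∧_ ; _∨_ = L._∨_ }) proj₁
    proj₁-isMonomorphism = record
      { isLatticeHomomorphism = record
        { isRelHomomorphism = record { cong = λ p → p }
        ; ∧-homo = λ _ _ → L′.⟦⟧₂-cong ∧op L′.refl L′.refl
        ; ∨-homo = λ _ _ → L′.⟦⟧₂-cong ∨op L′.refl L′.refl }
      ; injective = λ p → p }

  lattice : LLattice 𝓛 a
  lattice = record
    { algebra   = algebra
    ; isLattice = LatticeMonomorphism.isLattice proj₁-isMonomorphism L.isLattice }

  inclusion : Embedding lattice L
  inclusion = record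
    { hom       = record { fun = proj₁ ; isHom = record { cong = λ p → p ; hom = λ _ _ → L′.refl } }
    ; injective = λ p → p }

module Modal {𝓛 : Signature} {a : Level} (M : MLLattice 𝓛 a) where
  open Signature 𝓛
  open MLLattice M
  private
    module M′ = LatticeOrder lattice

  Fixed : Pred Carrier a
  Fixed x = □ x ≈ x

  □-fixed : ∀ x → Fixed (□ x)
  □-fixed x = M′.trans (□-cong (M′.sym (ax6 x))) (M′.trans (ax3 (□ x)) (ax6 x))

  ◇-fixed : ∀ x → Fixed (◇ x)
  ◇-fixed = ax3

  □-mono : ∀ {x y} → x ≤ y → □ x ≤ □ y
  □-mono {x} {y} p = M′.trans (M′.sym (ax2 x y)) (□-cong p)

  ◇-mono : ∀ {x y} → x ≤ y → ◇ x ≤ ◇ y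
  ◇-mono {x} {y} p =
    M′.≤-resp-≈ M′.refl (M′.trans (M′.sym (ax5 y x)) (◇-cong (M′.≤⇒∨≈ p))) (M′.x≤y∨x (◇ x) (◇ y))

  x≤◇x : ∀ x → x ≤ ◇ x
  x≤◇x x = M′.≤-resp-≈ M′.refl (ax4 x) (M′.x≤y∨x x (◇ x))

  fixed-≤-□ : ∀ {s x} → Fixed s → s ≤ x → s ≤ □ x
  fixed-≤-□ s-fixed p = M′.≤-resp-≈ s-fixed M′.refl (□-mono p)

  ◇-≤-fixed : ∀ {s x} → Fixed s → x ≤ s → ◇ x ≤ s
  ◇-≤-fixed {s} s-fixed p =
    M′.≤-resp-≈ M′.refl (M′.trans (◇-cong (M′.sym s-fixed)) (M′.trans (ax6 s) s-fixed)) (◇-mono p)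

  Fixed-closed : ∀ {n} (o : Op n) (xs : Fin n → Carrier) → (∀ i → Fixed (xs i)) → Fixed (⟦ o ⟧ xs)
  Fixed-closed o xs fixed =
    M′.trans (□-cong xs≈□xs) (M′.trans (ax7 o xs) (M′.sym xs≈□xs))
    where
      xs≈□xs : ⟦ o ⟧ xs ≈ ⟦ o ⟧ (λ i → □ (xs i))
      xs≈□xs = ⟦⟧-cong o (λ i → M′.sym (fixed i))

  open Subalgebra lattice Fixed Fixed-closed public
    renaming (lattice to fixedLattice; inclusion to fixedInclusion)
    using ()

m≤′m⊔n : ∀ m n → m ≤′ m ⊔ n
m≤′m⊔n m n = ≤⇒≤′ (m≤m⊔n m n)

m≤′n⊔m : ∀ m n → m ≤′ n ⊔ m
m≤′n⊔m m n = ≤⇒≤′ (m≤n⊔m n m)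

⊔-lub′ : ∀ {m n o} → m ≤′ o → n ≤′ o → m ⊔ n ≤′ o
⊔-lub′ p q = ≤⇒≤′ (⊔-lub (≤′⇒≤ p) (≤′⇒≤ q))

1+n≰′n : ∀ {n} → suc n ≤′ n → ⊥
1+n≰′n = 1+n≰n ∘ ≤′⇒≤

⨆ : ∀ {j} → (Fin j → ℕ) → ℕ
⨆ {zero}  _ = 0
⨆ {suc j} f = f zero ⊔ ⨆ (f ∘ suc)

≤′-⨆ : ∀ {j} (f : Fin j → ℕ) i → f i ≤′ ⨆ f
≤′-⨆ f zero    = m≤′m⊔n _ _
≤′-⨆ f (suc i) = ≤′-trans (≤′-⨆ (f ∘ suc) i) (m≤′n⊔m _ _)

⨆-least : ∀ {j} (f : Fin j → ℕ) {k} → (∀ i → f i ≤′ k) → ⨆ f ≤′ k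
⨆-least {zero}  _ _     = z≤′n
⨆-least {suc j} f bound = ⊔-lub′ (bound zero) (⨆-least (f ∘ suc) (bound ∘ suc))

module ChainLimit {𝓛 : Signature} {a : Level} (A : ℕ → LLattice 𝓛 a)
  (step : ∀ n → Embedding (A n) (A (suc n))) where
  open Signature 𝓛
  private
    module A (n : ℕ) = LLattice (A n)
    module A′ (n : ℕ) = LatticeOrder (A n)

  transition : ∀ {m n} → m ≤′ n → Embedding (A m) (A n)
  transition ≤′-refl      = idᴱ _
  transition (≤′-step p) = step _ ∘ᴱ transition p

  tr : ∀ {m n} → m ≤′ n → A.Carrier m → A.Carrier n
  tr p = Embedding.fun (transition p)

  tr-irrelevant : ∀ {m n} (p q : m ≤′ n) x → A._≈_ n (tr p x) (tr q x)
  tr-irrelevant ≤′-refl      ≤′-refl      _ = A′.refl _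
  tr-irrelevant ≤′-refl      (≤′-step q) _ = ⊥-elim (1+n≰′n q)
  tr-irrelevant (≤′-step p) ≤′-refl      _ = ⊥-elim (1+n≰′n p)
  tr-irrelevant (≤′-step p) (≤′-step q) x = Embedding.cong (step _) (tr-irrelevant p q x)

  tr-trans : ∀ {l m n} (p : l ≤′ m) (q : m ≤′ n) (r : l ≤′ n) x →
             A._≈_ n (tr q (tr p x)) (tr r x)
  tr-trans p q r x = A′.trans _ (composite p q x) (tr-irrelevant (≤′-trans p q) r x)
    where
      composite : ∀ {l m n} (p : l ≤′ m) (q : m ≤′ n) x →
                  A._≈_ n (tr q (tr p x)) (tr (≤′-trans p q) x)
      composite p ≤′-refl      x = A′.refl _
      composite p (≤′-step q) x = Embedding.cong (step _) (composite p q x)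

  Elem : Set a
  Elem = Σ ℕ A.Carrier

  stage : Elem → ℕ
  stage = proj₁

  infixl 9 _↑_
  _↑_ : ∀ {k} (u : Elem) → stage u ≤′ k → A.Carrier k
  u ↑ p = tr p (proj₂ u)

  infix 4 _≋_
  _≋_ : Elem → Elem → Set a
  u ≋ v = ∃[ k ] Σ (stage u ≤′ k) λ p → Σ (stage v ≤′ k) λ q → A._≈_ k (u ↑ p) (v ↑ q)

  ↑-trans : ∀ u {k l} (p : stage u ≤′ k) (q : k ≤′ l) (r : stage u ≤′ l) →
            A._≈_ l (tr q (u ↑ p)) (u ↑ r)
  ↑-trans u p q r = tr-trans p q r (proj₂ u)

  -- Injective transitions let equality descend from the witnessing stage to any common stage.
  ≋⇒≈↑ : ∀ {u v} → u ≋ v → ∀ {k} (p : stage u ≤′ k) (q : stage v ≤′ k) → A._≈_ k (u ↑ p) (v ↑ q)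
  ≋⇒≈↑ {u} {v} (l , p′ , q′ , e) {k} p q = Embedding.injective (transition k≤′n) (begin
    tr k≤′n (u ↑ p)   ≈⟨ ↑-trans u p k≤′n u≤′n ⟩
    u ↑ u≤′n          ≈⟨ ↑-trans u p′ l≤′n u≤′n ⟨
    tr l≤′n (u ↑ p′)  ≈⟨ Embedding.cong (transition l≤′n) e ⟩
    tr l≤′n (v ↑ q′)  ≈⟨ ↑-trans v q′ l≤′n v≤′n ⟩
    v ↑ v≤′n          ≈⟨ ↑-trans v q k≤′n v≤′n ⟨
    tr k≤′n (v ↑ q)   ∎)
    where
      n = l ⊔ k
      l≤′n = m≤′m⊔n l k
      k≤′n = m≤′n⊔m k l
      u≤′n = ≤′-trans p′ l≤′n
      v≤′n = ≤′-trans q′ l≤′n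
      open ≈-Reasoning (A′.setoid n)

  ≋-refl : ∀ {u} → u ≋ u
  ≋-refl {n , x} = n , ≤′-refl , ≤′-refl , A′.refl n

  ≋-sym : ∀ {u v} → u ≋ v → v ≋ u
  ≋-sym (k , p , q , e) = k , q , p , A′.sym k e

  ≋-trans : ∀ {u v w} → u ≋ v → v ≋ w → u ≋ w
  ≋-trans {u} {v} {w} u≋v v≋w =
    k , pu , pw , A′.trans k (≋⇒≈↑ u≋v pu pv) (≋⇒≈↑ v≋w pv pw)
    where
      k = stage u ⊔ stage v ⊔ stage w
      pu = ≤′-trans (m≤′m⊔n (stage u) (stage v)) (m≤′m⊔n _ (stage w))
      pv = ≤′-trans (m≤′n⊔m (stage v) (stage u)) (m≤′m⊔n _ (stage w))
      pw = m≤′n⊔m (stage w) (stage u ⊔ stage v)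

  op : ∀ {j} → Op j → (Fin j → Elem) → Elem
  op o xs = ⨆ (stage ∘ xs) , A.⟦_⟧ _ o (λ i → xs i ↑ ≤′-⨆ (stage ∘ xs) i)

  op-↑ : ∀ {j} (o : Op j) xs {k} (r : stage (op o xs) ≤′ k) (ps : ∀ i → stage (xs i) ≤′ k) →
         A._≈_ k (op o xs ↑ r) (A.⟦_⟧ k o (λ i → xs i ↑ ps i))
  op-↑ o xs {k} r ps = A′.trans k (Hom.hom (toHom (transition r)) o _)
    (A.⟦⟧-cong k o (λ i → ↑-trans (xs i) (≤′-⨆ (stage ∘ xs) i) r (ps i)))

  op-cong : ∀ {j} (o : Op j) {xs ys : Fin j → Elem} → (∀ i → xs i ≋ ys i) → op o xs ≋ op o ys
  op-cong o {xs} {ys} xs≋ys = k , p , q ,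
    A′.trans k (op-↑ o xs p ps)
      (A′.trans k (A.⟦⟧-cong k o (λ i → ≋⇒≈↑ (xs≋ys i) (ps i) (qs i))) (A′.sym k (op-↑ o ys q qs)))
    where
      k = stage (op o xs) ⊔ stage (op o ys)
      p = m≤′m⊔n (stage (op o xs)) (stage (op o ys))
      q = m≤′n⊔m (stage (op o ys)) (stage (op o xs))
      ps = λ i → ≤′-trans (≤′-⨆ (stage ∘ xs) i) p
      qs = λ i → ≤′-trans (≤′-⨆ (stage ∘ ys) i) q

  algebra : Algebra 𝓛 a
  algebra = record
    { Carrier       = Elem
    ; _≈_           = _≋_
    ; isEquivalence = record { refl = ≋-refl ; sym = ≋-sym ; trans = ≋-trans }
    ; ⟦_⟧           = op
    ; ⟦⟧-cong       = op-cong
    }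

  private
    binary : ∀ k → Op 2 → A.Carrier k → A.Carrier k → A.Carrier k
    binary k b x y = A.⟦_⟧ k b (x ∷ y ∷ [])

    _⟨_⟩_ : Elem → Op 2 → Elem → Elem
    u ⟨ b ⟩ v = op b (u ∷ v ∷ [])

    ⟨⟩-stage : ∀ b u v {k} → stage u ≤′ k → stage v ≤′ k → stage (u ⟨ b ⟩ v) ≤′ k
    ⟨⟩-stage b u v p q = ⨆-least (stage ∘ (u ∷ v ∷ [])) λ { zero → p ; (suc zero) → q }

    ⟨⟩-↑ : ∀ b u v {k} (r : stage (u ⟨ b ⟩ v) ≤′ k) (p : stage u ≤′ k) (q : stage v ≤′ k) →
           A._≈_ k (u ⟨ b ⟩ v ↑ r) (binary k b (u ↑ p) (v ↑ q))
    ⟨⟩-↑ b u v {k} r p q = A′.trans k (op-↑ b (u ∷ v ∷ []) r λ { zero → p ; (suc zero) → q })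
                                      (A′.⟦⟧₂-cong k b (A′.refl k) (A′.refl k))

    module _ (b : Op 2) where
      open AlgebraDefinitions

      comm-law : (∀ k → Commutative (A._≈_ k) (binary k b)) → Commutative _≋_ _⟨ b ⟩_
      comm-law comm u v = k , l , r , (begin
        u ⟨ b ⟩ v ↑ l            ≈⟨ ⟨⟩-↑ b u v l pu pv ⟩
        (u ↑ pu) ∙ (v ↑ pv)      ≈⟨ comm k _ _ ⟩
        (v ↑ pv) ∙ (u ↑ pu)      ≈⟨ ⟨⟩-↑ b v u r pv pu ⟨
        v ⟨ b ⟩ u ↑ r            ∎)
        where
          k = stage u ⊔ stage v
          pu = m≤′m⊔n (stage u) (stage v)
          pv = m≤′n⊔m (stage v) (stage u)
          l = ⟨⟩-stage b u v pu pv
          r = ⟨⟩-stage b v u pv pu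
          _∙_ = binary k b
          open ≈-Reasoning (A′.setoid k)

      assoc-law : (∀ k → Associative (A._≈_ k) (binary k b)) → Associative _≋_ _⟨ b ⟩_
      assoc-law assoc u v w = k , l , r , (begin
        (u ⟨ b ⟩ v) ⟨ b ⟩ w ↑ l              ≈⟨ ⟨⟩-↑ b (u ⟨ b ⟩ v) w l puv pw ⟩
        (u ⟨ b ⟩ v ↑ puv) ∙ (w ↑ pw)          ≈⟨ ∙-cong (⟨⟩-↑ b u v puv pu pv) (A′.refl k) ⟩
        ((u ↑ pu) ∙ (v ↑ pv)) ∙ (w ↑ pw)      ≈⟨ assoc k _ _ _ ⟩
        (u ↑ pu) ∙ ((v ↑ pv) ∙ (w ↑ pw))      ≈⟨ ∙-cong (A′.refl k) (⟨⟩-↑ b v w pvw pv pw) ⟨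
        (u ↑ pu) ∙ (v ⟨ b ⟩ w ↑ pvw)          ≈⟨ ⟨⟩-↑ b u (v ⟨ b ⟩ w) r pu pvw ⟨
        u ⟨ b ⟩ (v ⟨ b ⟩ w) ↑ r               ∎)
        where
          k = stage u ⊔ stage v ⊔ stage w
          pu = ≤′-trans (m≤′m⊔n (stage u) (stage v)) (m≤′m⊔n _ (stage w))
          pv = ≤′-trans (m≤′n⊔m (stage v) (stage u)) (m≤′m⊔n _ (stage w))
          pw = m≤′n⊔m (stage w) (stage u ⊔ stage v)
          puv = ⟨⟩-stage b u v pu pv
          pvw = ⟨⟩-stage b v w pv pw
          l = ⟨⟩-stage b (u ⟨ b ⟩ v) w puv pw
          r = ⟨⟩-stage b u (v ⟨ b ⟩ w) pu pvw
          _∙_ = binary k b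
          ∙-cong = A′.⟦⟧₂-cong k b
          open ≈-Reasoning (A′.setoid k)

      absorbs-law : ∀ b′ → (∀ k → _Absorbs_ (A._≈_ k) (binary k b) (binary k b′)) →
                    _Absorbs_ _≋_ _⟨ b ⟩_ _⟨ b′ ⟩_
      absorbs-law b′ absorbs u v = k , l , pu , (begin
        u ⟨ b ⟩ (u ⟨ b′ ⟩ v) ↑ l              ≈⟨ ⟨⟩-↑ b u (u ⟨ b′ ⟩ v) l pu puv ⟩
        (u ↑ pu) ∙ (u ⟨ b′ ⟩ v ↑ puv)         ≈⟨ ∙-cong (A′.refl k) (⟨⟩-↑ b′ u v puv pu pv) ⟩
        (u ↑ pu) ∙ ((u ↑ pu) ∙′ (v ↑ pv))     ≈⟨ absorbs k _ _ ⟩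
        u ↑ pu                                ∎)
        where
          k = stage u ⊔ stage v
          pu = m≤′m⊔n (stage u) (stage v)
          pv = m≤′n⊔m (stage v) (stage u)
          puv = ⟨⟩-stage b′ u v pu pv
          l = ⟨⟩-stage b u (u ⟨ b′ ⟩ v) pu puv
          _∙_ = binary k b
          _∙′_ = binary k b′
          ∙-cong = A′.⟦⟧₂-cong k b
          open ≈-Reasoning (A′.setoid k)

  isLattice : IsLattice _≋_ (Algebra._∨_ algebra) (Algebra._∧_ algebra)
  isLattice = record
    { isEquivalence = Algebra.isEquivalence algebra
    ; ∨-comm        = comm-law ∨op (IsLattice.∨-comm ∘ A.isLattice)
    ; ∨-assoc       = assoc-law ∨op (IsLattice.∨-assoc ∘ A.isLattice)
    ; ∨-cong        = λ p q → op-cong ∨op λ { zero → p ; (suc zero) → q }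
    ; ∧-comm        = comm-law ∧op (IsLattice.∧-comm ∘ A.isLattice)
    ; ∧-assoc       = assoc-law ∧op (IsLattice.∧-assoc ∘ A.isLattice)
    ; ∧-cong        = λ p q → op-cong ∧op λ { zero → p ; (suc zero) → q }
    ; absorptive    = absorbs-law ∨op ∧op (proj₁ ∘ IsLattice.absorptive ∘ A.isLattice)
                    , absorbs-law ∧op ∨op (proj₂ ∘ IsLattice.absorptive ∘ A.isLattice)
    }

  limit : LLattice 𝓛 a
  limit = record { algebra = algebra ; isLattice = isLattice }

  private
    module Lim = LLattice limit

  ι : ∀ n → Hom (A n) limit
  ι n = record
    { fun   = n ,_
    ; isHom = record { cong = λ e → n , ≤′-refl , ≤′-refl , e ; hom = ι-hom } }
    where
      ι-hom : ∀ {j} (o : Op j) (xs : Fin j → A.Carrier n) →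
              (n , A.⟦_⟧ n o xs) ≋ op o (λ i → n , xs i)
      ι-hom o xs = k , p , q , A′.trans k (Hom.hom (toHom (transition p)) o xs)
                                           (A′.sym k (op-↑ o (λ i → n , xs i) q λ _ → p))
        where
          k = n ⊔ stage (op o (λ i → n , xs i))
          p = m≤′m⊔n n _
          q = m≤′n⊔m _ n

  ι-transition : ∀ {m n} (p : m ≤′ n) x → (m , x) ≋ (n , tr p x)
  ι-transition {n = n} p x = n , p , ≤′-refl , A′.refl n

  ι-injective : ∀ {n x y} → (n , x) ≋ (n , y) → A._≈_ n x y
  ι-injective e = ≋⇒≈↑ e ≤′-refl ≤′-refl

  ≤⇒≤↑ : ∀ {u v} → u Lim.≤ v → ∀ {k} (p : stage u ≤′ k) (q : stage v ≤′ k) → A._≤_ k (u ↑ p) (v ↑ q)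
  ≤⇒≤↑ {u} {v} u∧v≋u {k} p q = A′.trans k (A′.sym k (⟨⟩-↑ ∧op u v r p q)) (≋⇒≈↑ u∧v≋u r p)
    where r = ⟨⟩-stage ∧op u v p q

  system : DirectedSystem
  system = record
    { I         = Lift a ℕ
    ; _≼_       = λ m n → Lift a (lower m ≤′ lower n)
    ; ≼-refl    = λ _ → lift ≤′-refl
    ; ≼-trans   = λ p q → lift (≤′-trans (lower p) (lower q))
    ; inhabited = lift 0
    ; directed  = λ m n → lift (lower m ⊔ lower n)
                        , lift (m≤′m⊔n (lower m) (lower n)) , lift (m≤′n⊔m (lower n) (lower m))
    ; D         = A ∘ lower
    ; f         = toHom ∘ transition ∘ lower
    ; f-id      = λ p → tr-irrelevant (lower p) ≤′-refl
    ; f-comp    = λ p q r → tr-trans (lower p) (lower q) (lower r)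
    }

  cocone : Cocone system limit
  cocone = record
    { g      = ι ∘ lower
    ; g-comm = λ p x → ≋-sym (ι-transition (lower p) x) }

  isDirectLimit : IsDirectLimit system limit cocone
  isDirectLimit E ε =
    mediator , (λ _ _ → E′.refl) , (λ _ agrees y → agrees (lift (stage y)) (proj₂ y))
    where
      module E = LLattice E
      module E′ = LatticeOrder E
      g : ∀ n → A.Carrier n → E.Carrier
      g n = Hom.fun (Cocone.g ε (lift n))
      g-tr : ∀ {m n} (p : m ≤′ n) x → g n (tr p x) E.≈ g m x
      g-tr p = Cocone.g-comm ε (lift p)
      mediator : Hom limit E
      mediator = record
        { fun   = λ u → g (stage u) (proj₂ u)
        ; isHom = record
          { cong = λ { (k , p , q , e) → E′.trans (E′.sym (g-tr p _))
                                            (E′.trans (Hom.cong (Cocone.g ε (lift k)) e) (g-tr q _)) }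
          ; hom  = λ o xs → E′.trans (Hom.hom (Cocone.g ε (lift (stage (op o xs)))) o _)
                              (E.⟦⟧-cong o (λ i → g-tr (≤′-⨆ (stage ∘ xs) i) (proj₂ (xs i)))) } }

module _ {𝓛 : Signature} {a k : Level} {K : Class 𝓛 a k} {V : VFormation K}
         (amalgam : Superamalgam K V) where
  open VFormation V using (B₂; f₂)
  open Superamalgam amalgam
  private
    module B₂ = LLattice B₂
    module C = LLattice C
    module C′ = LatticeOrder C
    ⟦f₂⟧ = Embedding.fun f₂
    ⟦g₁⟧ = Embedding.fun g₁
    ⟦g₂⟧ = Embedding.fun g₂

  interpolant₁₂ : ∀ b₁ b₂ → ⟦g₁⟧ b₁ C.≤ ⟦g₂⟧ b₂ →
                  ∃[ x ] (⟦g₁⟧ b₁ C.≤ ⟦g₂⟧ (⟦f₂⟧ x) × ⟦f₂⟧ x B₂.≤ b₂)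
  interpolant₁₂ b₁ b₂ g₁b₁≤g₂b₂ with super₁₂ b₁ b₂ g₁b₁≤g₂b₂
  ... | x , below , same , above = x , C′.≤-resp-≈ C′.refl same below , ≤-reflect g₂ above

  interpolant₂₁ : ∀ b₁ b₂ → ⟦g₂⟧ b₂ C.≤ ⟦g₁⟧ b₁ →
                  ∃[ x ] (b₂ B₂.≤ ⟦f₂⟧ x × ⟦g₂⟧ (⟦f₂⟧ x) C.≤ ⟦g₁⟧ b₁)
  interpolant₂₁ b₁ b₂ g₂b₂≤g₁b₁ with super₂₁ b₁ b₂ g₂b₂≤g₁b₁
  ... | x , below , same , above = x , ≤-reflect g₂ below , C′.≤-resp-≈ (C′.sym same) C′.refl above

module Functionalisation {𝓛 : Signature} {a k : Level} (K : Class 𝓛 a k)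
  (subalgebras : ClosedUnderSubalgebras K) (sap : SuperamalgamationProperty K)
  (M : MLLattice 𝓛 a) (M∈K : M ∈m K) where
  open Signature 𝓛
  open MLLattice M using (□; ◇; ax1)
  open Modal M
  private
    M₀ = MLLattice.lattice M
    module M₀ = LLattice M₀

  Fix : LLattice 𝓛 a
  Fix = fixedLattice

  Fix∈K : K Fix
  Fix∈K = subalgebras M₀ Fix fixedInclusion M∈K

  record Stage : Set (Level.suc a Level.⊔ k) where
    field
      A   : LLattice 𝓛 a
      A∈K : K A
      e   : Embedding Fix A
      c   : Embedding M₀ A
      e≈c : ∀ s → LLattice._≈_ A (Embedding.fun e s) (Embedding.fun c (proj₁ s))

  initial : Stage
  initial = record
    { A = M₀ ; A∈K = M∈K ; e = fixedInclusion ; c = idᴱ M₀ ; e≈c = λ _ → LatticeOrder.refl M₀ }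

  vFormation : Stage → VFormation K
  vFormation σ = record
    { A = Fix ; B₁ = Stage.A σ ; B₂ = M₀ ; A∈K = Fix∈K ; B₁∈K = Stage.A∈K σ ; B₂∈K = M∈K
    ; f₁ = Stage.e σ ; f₂ = fixedInclusion }

  amalgam : (σ : Stage) → Superamalgam K (vFormation σ)
  amalgam σ = sap (vFormation σ)

  next : Stage → Stage
  next σ = record
    { A = C ; A∈K = C∈K ; e = g₁ ∘ᴱ Stage.e σ ; c = g₂ ; e≈c = comm }
    where open Superamalgam (amalgam σ)

  stages : ℕ → Stage
  stages zero    = initial
  stages (suc n) = next (stages n)

  open ChainLimit (Stage.A ∘ stages) (λ n → Superamalgam.g₁ (amalgam (stages n))) public

  private
    module Aₙ (n : ℕ) = LLattice (Stage.A (stages n))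
    module Aₙ′ (n : ℕ) = LatticeOrder (Stage.A (stages n))
    module Lim = LLattice limit
    module Lim′ = LatticeOrder limit

  embed : ∀ n → M₀.Carrier → Aₙ.Carrier n
  embed n = Embedding.fun (Stage.c (stages n))

  tr-fixed : ∀ {n} (p : 0 ≤′ n) s → Aₙ._≈_ n (tr p (proj₁ s)) (Embedding.fun (Stage.e (stages n)) s)
  tr-fixed ≤′-refl      s = Aₙ′.refl 0
  tr-fixed (≤′-step {n} p) s = Embedding.cong (Superamalgam.g₁ (amalgam (stages n))) (tr-fixed p s)

  fixed-constant : ∀ n s → (0 , proj₁ s) ≋ (n , embed n (proj₁ s))
  fixed-constant n s =
    n , z≤′n , ≤′-refl , Aₙ′.trans n (tr-fixed {n} z≤′n s) (Stage.e≈c (stages n) s)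

  module _ (n : ℕ) where
    open Superamalgam (amalgam (stages n)) using (g₁; g₂)
    private
      step↑ = Embedding.fun g₁

    □-step : ∀ t x → Aₙ._≤_ (suc n) (step↑ t) (embed (suc n) x) →
             Aₙ._≤_ (suc n) (step↑ t) (embed (suc n) (□ x))
    □-step t x t≤x with interpolant₁₂ (amalgam (stages n)) t x t≤x
    ... | s , t≤s , s≤x = Aₙ′.≤-trans (suc n) t≤s (≤-homo (toHom g₂) (fixed-≤-□ (proj₂ s) s≤x))

    ◇-step : ∀ t x → Aₙ._≤_ (suc n) (embed (suc n) x) (step↑ t) →
             Aₙ._≤_ (suc n) (embed (suc n) (◇ x)) (step↑ t)
    ◇-step t x x≤t with interpolant₂₁ (amalgam (stages n)) t x x≤t
    ... | s , x≤s , s≤t = Aₙ′.≤-trans (suc n) (≤-homo (toHom g₂) (◇-≤-fixed (proj₂ s) x≤s)) s≤t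

  Worlds : Set a
  Worlds = Lift a ℕ

  represent : M₀.Carrier → Worlds → Elem
  represent x (lift n) = n , embed n x

  represent-hom : ∀ {j} (o : Op j) (xs : Fin j → M₀.Carrier) v →
                  represent (M₀.⟦ o ⟧ xs) v ≋ op o (λ i → represent (xs i) v)
  represent-hom o xs (lift n) =
    ≋-trans (Hom.cong (ι n) (Hom.hom (toHom (Stage.c (stages n))) o xs)) (Hom.hom (ι n) o _)

  represent-mono : ∀ {x y} v → x M₀.≤ y → represent x v Lim.≤ represent y v
  represent-mono (lift n) x≤y = ≤-homo (ι n) (≤-homo (toHom (Stage.c (stages n))) x≤y)

  □-constant : ∀ x v → (0 , □ x) ≋ represent (□ x) v
  □-constant x (lift n) = fixed-constant n (□ x , □-fixed x)

  ◇-constant : ∀ x v → (0 , ◇ x) ≋ represent (◇ x) v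
  ◇-constant x (lift n) = fixed-constant n (◇ x , ◇-fixed x)

  □-lower : ∀ x v → (0 , □ x) Lim.≤ represent x v
  □-lower x v = Lim′.≤-resp-≈ (≋-sym (□-constant x v)) ≋-refl (represent-mono v (ax1 x))

  □-greatest : ∀ x z → z Lim.≤ represent x (lift (suc (stage z))) → z Lim.≤ (0 , □ x)
  □-greatest x (m , t) z≤x =
    Lim′.≤-resp-≈ (≋-sym (ι-transition one t)) (≋-sym (□-constant x (lift (suc m))))
      (≤-homo (ι (suc m)) (□-step m t x (≤⇒≤↑ z≤x one ≤′-refl)))
    where one = ≤′-step ≤′-refl

  ◇-upper : ∀ x v → represent x v Lim.≤ (0 , ◇ x)
  ◇-upper x v = Lim′.≤-resp-≈ ≋-refl (≋-sym (◇-constant x v)) (represent-mono v (x≤◇x x))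

  ◇-least : ∀ x z → represent x (lift (suc (stage z))) Lim.≤ z → (0 , ◇ x) Lim.≤ z
  ◇-least x (m , t) x≤z =
    Lim′.≤-resp-≈ (≋-sym (◇-constant x (lift (suc m)))) (≋-sym (ι-transition one t))
      (≤-homo (ι (suc m)) (◇-step m t x (≤⇒≤↑ x≤z ≤′-refl one)))
    where one = ≤′-step ≤′-refl

  Represented : Pred (Worlds → Elem) a
  Represented f = ∃[ x ] (∀ v → f v ≋ represent x v)

  ⋀-represented : ∀ {f} x → (∀ v → f v ≋ represent x v) → IsMeet limit Worlds f (0 , □ x)
  ⋀-represented x f≋x =
    (λ v → Lim′.≤-resp-≈ ≋-refl (≋-sym (f≋x v)) (□-lower x v)) ,
    (λ z z≤f → □-greatest x z (Lim′.≤-resp-≈ ≋-refl (f≋x _) (z≤f _)))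

  ⋁-represented : ∀ {f} x → (∀ v → f v ≋ represent x v) → IsJoin limit Worlds f (0 , ◇ x)
  ⋁-represented x f≋x =
    (λ v → Lim′.≤-resp-≈ (≋-sym (f≋x v)) ≋-refl (◇-upper x v)) ,
    (λ z f≤z → ◇-least x z (Lim′.≤-resp-≈ (f≋x _) ≋-refl (f≤z _)))

  functional : Functional limit Worlds
  functional = record
    { B      = Represented
    ; closed = λ o fs fs∈ → M₀.⟦ o ⟧ (proj₁ ∘ fs∈) ,
                 λ v → ≋-trans (op-cong o (λ i → proj₂ (fs∈ i) v)) (≋-sym (represent-hom o _ v))
    ; ⋀      = λ _ (x , _) → 0 , □ x
    ; ⋀-meet = λ _ (x , f≋x) → ⋀-represented x f≋x
    ; ⋁      = λ _ (x , _) → 0 , ◇ x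
    ; ⋁-join = λ _ (x , f≋x) → ⋁-represented x f≋x
    ; □-in   = λ _ (x , _) → □ x , □-constant x
    ; ◇-in   = λ _ (x , _) → ◇ x , ◇-constant x
    }

  isoToFunctional : IsoToFunctional M limit Worlds functional
  isoToFunctional = record
    { h      = λ x → represent x , x , λ _ → ≋-refl
    ; h-cong = λ { e (lift n) → Hom.cong (ι n) (Embedding.cong (Stage.c (stages n)) e) }
    ; h-inj  = λ e → ι-injective (e (lift 0))
    ; h-surj = λ { (f , x , f≋x) → x , ≋-sym ∘ f≋x }
    ; h-op   = represent-hom
    ; h-□    = λ x → ≋-sym ∘ □-constant x
    ; h-◇    = λ x → ≋-sym ∘ ◇-constant x
    }

theorem4p1 : {a k : Level} (𝓛 : Signature) (K : Class 𝓛 a k) →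
    ClosedUnderDirectLimits K → ClosedUnderSubalgebras K →
    SuperamalgamationProperty K →
    (M : MLLattice 𝓛 a) → M ∈m K → KFunctional K M
theorem4p1 𝓛 K directLimits subalgebras sap M M∈K =
  limit , directLimits system (Stage.A∈K ∘ stages ∘ lower) limit cocone isDirectLimit ,
  Worlds , functional , isoToFunctional
  where open Functionalisation K subalgebras sap M M∈K
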